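{- Let $w\ge 1$ and $k\ge 2$ be integers and let $a,b,c$ be integers with $0\le a,b,c<w$. Consider the $\texttt{xoroshiro+}$ generator with $w$ bits of output and $kw$ bits of state, i.e. state $(s_0,\dots,s_{k-1})$ of $w$-bit words, next-state map \[ s'_j=s_{j+1}\ (0\le j\le k-3),\quad s'_{k-2}=\mathrm{rotl}(s_0,a)\oplus s_0\oplus s_{k-1}\oplus\bigl((s_0\oplus s_{k-1})\ll b\bigr),\quad s'_{k-1}=\mathrm{rotl}(s_0\oplus s_{k-1},c), \] and output $s_0+s_{k-1}\bmod 2^w$ (the sum scrambler applied to the first and last word of state). Then this generator is $(k-1)$-dimensionally equidistributed.
   Context: A $w$-bit word is an element of $\{0,1\}^w$, identified with an integer in $[0,2^w)$ whose bit $i$ is the coefficient of $2^i$. $\oplus$ is bitwise xor, $x\ll b$ is the left shift $x\cdot 2^b \bmod 2^w$, $\mathrm{rotl}(x,r)$ is the left rotation of $x$ by $r$ positions, and $+$ between words denotes addition in $\mathbf Z/2^w\mathbf Z$. (In matrix form the next-state map is $s\mapsto s\mathscr X_{kw}$ for the $kw\times kw$ matrix over $\mathbf Z/2\mathbf Z$ whose first block row is $(0,\dots,0,R^a+S^b+I,R^c)$, whose block row $i$ for $1\le i\le k-2$ has $I$ in block column $i-1$ and zeros elsewhere, and whose last block row is $(0,\dots,0,S^b+I,R^c)$, with $S$ the one-position left shift and $R$ the one-position left rotation.) A generator with $kw$ bits of state, next-state map $T$ and $w$-bit output function $\varphi$ is $d$-dimensionally equidistributed ($d\le k$) if, as $s$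 ranges over all nonzero states, every $d$-tuple $(\varphi(s),\varphi(Ts),\dots,\varphi(T^{d-1}s))$ of $w$-bit words appears exactly $2^{w(k-d)}$ times, except the all-zero $d$-tuple, which appears $2^{w(k-d)}-1$ times. -}

module Defs where

open import Data.Nat using (ℕ; zero; suc; _+_; _*_; _∸_; _^_; _%_; _/_; _≡ᵇ_)
open import Data.Bool using (Bool; true; false; _xor_; if_then_else_)
open import Data.Bool.Properties using () renaming (_≟_ to _≟B_)
open import Data.Vec using (Vec; []; _∷_; replicate; zipWith)
open import Data.Vec.Properties using (≡-dec)
open import Data.List using (List; []; _∷_; concatMap; map; filter; length)
open import Data.Product using (_×_)
open import Relation.Nullary using (¬_; ¬?)
open import Relation.Nullary.Decidable using (_×-dec_)
open import Relation.Binary.PropositionalEquality using (_≡_; _≢_)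
open import Relation.Binary using (DecidableEquality)

-- A w-bit word; the i-th entry of the vector is bit i (coefficient of 2^i).
Word : ℕ → Set
Word w = Vec Bool w

_≟W_ : ∀ {w} → DecidableEquality (Word w)
_≟W_ = ≡-dec _≟B_

zeroW : ∀ w → Word w
zeroW w = replicate w false

val : ∀ {w} → Word w → ℕ
val [] = 0
val (b ∷ bs) = (if b then 1 else 0) + 2 * val bs

fromℕW : ∀ w → ℕ → Word w
fromℕW zero n = []
fromℕW (suc w) n = (n % 2 ≡ᵇ 1) ∷ fromℕW w (n / 2)

initV : ∀ {A : Set} {n} → Vec A (suc n) → Vec A n
initV (x ∷ []) = []
initV (x ∷ y ∷ ys) = x ∷ initV (y ∷ ys)

lastV : ∀ {A : Set} {n} → Vec A (suc n) → A
lastV (x ∷ []) = x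
lastV (x ∷ y ∷ ys) = lastV (y ∷ ys)

_⊕_ : ∀ {w} → Word w → Word w → Word w
_⊕_ = zipWith _xor_

_+W_ : ∀ {w} → Word w → Word w → Word w
_+W_ {w} x y = fromℕW w (val x + val y)

shl1 : ∀ {w} → Word w → Word w
shl1 [] = []
shl1 (x ∷ xs) = false ∷ initV (x ∷ xs)

rotl1 : ∀ {w} → Word w → Word w
rotl1 [] = []
rotl1 (x ∷ xs) = lastV (x ∷ xs) ∷ initV (x ∷ xs)

iter : ∀ {A : Set} → ℕ → (A → A) → A → A
iter zero f x = x
iter (suc n) f x = f (iter n f x)

_≪_ : ∀ {w} → Word w → ℕ → Word w
x ≪ b = iter b shl1 x

rotl : ∀ {w} → Word w → ℕ → Word w
rotl x r = iter r rotl1 x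

State : ℕ → ℕ → Set
State w k = Vec (Word w) k

snoc2 : ∀ {A : Set} {n} → Vec A n → A → A → Vec A (suc (suc n))
snoc2 [] x y = x ∷ y ∷ []
snoc2 (z ∷ zs) x y = z ∷ snoc2 zs x y

xoroshiroNext : ∀ {w} m (a b c : ℕ) → State w (suc (suc m)) → State w (suc (suc m))
xoroshiroNext m a b c (s₀ ∷ rest) =
  snoc2 (initV rest)
        (((rotl s₀ a ⊕ s₀) ⊕ sk) ⊕ ((s₀ ⊕ sk) ≪ b))
        (rotl (s₀ ⊕ sk) c)
  where sk = lastV rest

xoroshiroPlusOut : ∀ {w} m → State w (suc (suc m)) → Word w
xoroshiroPlusOut m (s₀ ∷ rest) = s₀ +W lastV rest

allVecs : ∀ {A : Set} → List A → (n : ℕ) → List (Vec A n)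
allVecs xs zero = [] ∷ []
allVecs xs (suc n) = concatMap (λ x → map (x ∷_) (allVecs xs n)) xs

allWords : ∀ w → List (Word w)
allWords w = allVecs (false ∷ true ∷ []) w

allStates : ∀ w k → List (State w k)
allStates w k = allVecs (allWords w) k

outputs : ∀ {w k} → (State w k → State w k) → (State w k → Word w) →
          (d : ℕ) → State w k → Vec (Word w) d
outputs T φ zero s = []
outputs T φ (suc d) s = φ s ∷ outputs T φ d (T s)

countTuple : ∀ {w k} → (State w k → State w k) → (State w k → Word w) →
             (d : ℕ) → Vec (Word w) d → ℕ
countTuple {w} {k} T φ d t =
  length (filter (λ s → ¬? (s ≟S replicate k (zeroW w)) ×-dec (outputs T φ d s ≟T t))
                 (allStates w k))
  where
    _≟S_ = ≡-dec (_≟W_ {w})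
    _≟T_ = ≡-dec (_≟W_ {w})

Equidistributed : ∀ w k → (State w k → State w k) → (State w k → Word w) → ℕ → Set
Equidistributed w k T φ d =
  (t : Vec (Word w) d) →
    (t ≡ replicate d (zeroW w) → countTuple T φ d t ≡ 2 ^ (w * (k ∸ d)) ∸ 1)
    × (t ≢ replicate d (zeroW w) → countTuple T φ d t ≡ 2 ^ (w * (k ∸ d)))

-- During the first k − 1 steps the first word of the state runs through s₀, …, s_{k−2}: the new
-- words are appended at the back and do not reach the front in time. Meanwhile the last word
-- evolves as ℓ₀ = s_{k−1}, ℓ_{j+1} = rotl(s_j ⊕ ℓ_j, c), so the outputs are o_j = s_j + ℓ_j.
-- Hence for each fixed s_{k−1} the map (s₀, …, s_{k−2}) ↦ (o₀, …, o_{k−2}) is a bijection, with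
-- inverse s_j = o_j − ℓ_j, and every (k−1)-tuple of outputs comes from exactly 2^w states, one
-- for each value of s_{k−1}. Removing the zero state, whose outputs are zero, gives the counts.
module Submission where

open import Defs
open import Data.Nat using (ℕ; zero; suc; _+_; _*_; _∸_; _^_; _%_; _/_; _≡ᵇ_; _≤_; _<_; s≤s; z≤n)
open import Data.Nat.Properties
open import Algebra.Properties.CommutativeSemigroup +-commutativeSemigroup using () renaming (interchange to +-interchange)
open import Data.Nat.DivMod
open import Data.Nat.Divisibility using (m∣m*n)
open import Data.Bool using (Bool; true; false; if_then_else_)
open import Data.Bool.Properties using () renaming (_≟_ to _≟B_)
open import Data.Vec using (Vec; []; _∷_; replicate; _∷ʳ_; toList)
open import Data.Vec.Properties using (toList-injective; cast-is-id) renaming (≡-dec to ≡-decVec)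
open import Data.List using (List; []; _∷_; _++_; [_]; length; filter; map; concatMap)
open import Data.List.Properties using (length-++; length-map; ++-assoc; ++-identityʳ)
open import Data.Product using (_×_; _,_)
open import Data.Empty using (⊥-elim)
open import Relation.Nullary using (Dec; yes; no; ¬_; does)
open import Relation.Nullary.Decidable using (_×-dec_; ¬?)
open import Relation.Unary using (Decidable)
open import Relation.Binary using (DecidableEquality)
open import Relation.Binary.PropositionalEquality hiding ([_])

-- Counting with indicators

private variable A B : Set

χ : {P : Set} → Dec P → ℕ
χ P? = if does P? then 1 else 0

∑ : List A → (A → ℕ) → ℕ
∑ [] f = 0
∑ (x ∷ xs) f = f x + ∑ xs f

syntax ∑ xs (λ x → e) = ∑[ x ∈ xs ] e

∑-cong : ∀ (xs : List A) {f g : A → ℕ} → (∀ x → f x ≡ g x) → ∑ xs f ≡ ∑ xs g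
∑-cong [] f≗g = refl
∑-cong (x ∷ xs) f≗g = cong₂ _+_ (f≗g x) (∑-cong xs f≗g)

∑-zero : ∀ (xs : List A) → ∑[ x ∈ xs ] 0 ≡ 0
∑-zero [] = refl
∑-zero (x ∷ xs) = ∑-zero xs

∑-const : ∀ (xs : List A) c → ∑[ x ∈ xs ] c ≡ length xs * c
∑-const [] c = refl
∑-const (x ∷ xs) c = cong (c +_) (∑-const xs c)

∑-distrib-+ : ∀ (xs : List A) (f g : A → ℕ) → ∑[ x ∈ xs ] (f x + g x) ≡ ∑ xs f + ∑ xs g
∑-distrib-+ [] f g = refl
∑-distrib-+ (x ∷ xs) f g =
  trans (cong (f x + g x +_) (∑-distrib-+ xs f g)) (+-interchange (f x) (g x) (∑ xs f) (∑ xs g))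

∑-*ˡ : ∀ (xs : List A) c (f : A → ℕ) → ∑[ x ∈ xs ] (c * f x) ≡ c * ∑ xs f
∑-*ˡ [] c f = sym (*-zeroʳ c)
∑-*ˡ (x ∷ xs) c f = trans (cong (c * f x +_) (∑-*ˡ xs c f)) (sym (*-distribˡ-+ c (f x) (∑ xs f)))

∑-swap : (xs : List A) (ys : List B) (f : A → B → ℕ) →
         ∑[ x ∈ xs ] ∑[ y ∈ ys ] f x y ≡ ∑[ y ∈ ys ] ∑[ x ∈ xs ] f x y
∑-swap [] ys f = sym (∑-zero ys)
∑-swap (x ∷ xs) ys f = trans (cong (∑ ys (f x) +_) (∑-swap xs ys f))
                             (sym (∑-distrib-+ ys (f x) (λ y → ∑[ x ∈ xs ] f x y)))

∑-++ : ∀ (xs ys : List A) (f : A → ℕ) → ∑ (xs ++ ys) f ≡ ∑ xs f + ∑ ys f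
∑-++ [] ys f = refl
∑-++ (x ∷ xs) ys f = trans (cong (f x +_) (∑-++ xs ys f)) (sym (+-assoc (f x) (∑ xs f) (∑ ys f)))

∑-concatMap : (g : B → List A) (ys : List B) (f : A → ℕ) →
              ∑ (concatMap g ys) f ≡ ∑[ y ∈ ys ] ∑ (g y) f
∑-concatMap g [] f = refl
∑-concatMap g (y ∷ ys) f = trans (∑-++ (g y) (concatMap g ys) f) (cong (∑ (g y) f +_) (∑-concatMap g ys f))

∑-map : (g : B → A) (ys : List B) (f : A → ℕ) → ∑ (map g ys) f ≡ ∑[ y ∈ ys ] f (g y)
∑-map g [] f = refl
∑-map g (y ∷ ys) f = cong (f (g y) +_) (∑-map g ys f)

length-filter : ∀ {P : A → Set} (P? : Decidable P) (xs : List A) →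
                length (filter P? xs) ≡ ∑[ x ∈ xs ] χ (P? x)
length-filter P? [] = refl
length-filter P? (x ∷ xs) with P? x
... | yes _ = cong suc (length-filter P? xs)
... | no _ = length-filter P? xs

length-concatMap : (g : B → List A) (ys : List B) →
                   length (concatMap g ys) ≡ ∑[ y ∈ ys ] length (g y)
length-concatMap g [] = refl
length-concatMap g (y ∷ ys) = trans (length-++ (g y)) (cong (length (g y) +_) (length-concatMap g ys))

χ-yes : ∀ {P : Set} (P? : Dec P) → P → χ P? ≡ 1
χ-yes (yes _) _ = refl
χ-yes (no ¬p) p = ⊥-elim (¬p p)

χ-no : ∀ {P : Set} (P? : Dec P) → ¬ P → χ P? ≡ 0
χ-no (yes p) ¬p = ⊥-elim (¬p p)
χ-no (no _) _ = refl

χ-× : ∀ {P Q : Set} (P? : Dec P) (Q? : Dec Q) → χ (P? ×-dec Q?) ≡ χ P? * χ Q?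
χ-× (yes _) (yes _) = refl
χ-× (yes _) (no _) = refl
χ-× (no _) (yes _) = refl
χ-× (no _) (no _) = refl

χ-¬?×+χ-× : ∀ {P Q : Set} (P? : Dec P) (Q? : Dec Q) → χ (¬? P? ×-dec Q?) + χ (P? ×-dec Q?) ≡ χ Q?
χ-¬?×+χ-× (yes _) (yes _) = refl
χ-¬?×+χ-× (yes _) (no _) = refl
χ-¬?×+χ-× (no _) (yes _) = refl
χ-¬?×+χ-× (no _) (no _) = refl

Enumerates : DecidableEquality A → List A → Set
Enumerates _≟_ xs = ∀ y → ∑[ x ∈ xs ] χ (x ≟ y) ≡ 1

Bool-enumerates : Enumerates _≟B_ (false ∷ true ∷ [])
Bool-enumerates false = refl
Bool-enumerates true = refl

allVecs-enumerates : ∀ {_≟_ : DecidableEquality A} (xs : List A) →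
                     Enumerates _≟_ xs → ∀ n → Enumerates (≡-decVec _≟_) (allVecs xs n)
allVecs-enumerates xs enum zero [] = refl
allVecs-enumerates {A} {_≟_} xs enum (suc n) (y ∷ ys) = begin
  ∑[ v ∈ concatMap (λ x → map (x ∷_) vs) xs ] χ (v ≟ᵥ (y ∷ ys))
    ≡⟨ ∑-concatMap (λ x → map (x ∷_) vs) xs _ ⟩
  ∑[ x ∈ xs ] ∑[ v ∈ map (x ∷_) vs ] χ (v ≟ᵥ (y ∷ ys))
    ≡⟨ ∑-cong xs (λ x → ∑-map (x ∷_) vs _) ⟩
  ∑[ x ∈ xs ] ∑[ v ∈ vs ] χ ((x ≟ y) ×-dec (v ≟ᵥ ys))
    ≡⟨ ∑-cong xs (λ x → ∑-cong vs (λ v → χ-× (x ≟ y) (v ≟ᵥ ys))) ⟩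
  ∑[ x ∈ xs ] ∑[ v ∈ vs ] (χ (x ≟ y) * χ (v ≟ᵥ ys))
    ≡⟨ ∑-cong xs (λ x → ∑-*ˡ vs (χ (x ≟ y)) _) ⟩
  ∑[ x ∈ xs ] (χ (x ≟ y) * ∑[ v ∈ vs ] χ (v ≟ᵥ ys))
    ≡⟨ ∑-cong xs (λ x → trans (cong (χ (x ≟ y) *_) (allVecs-enumerates xs enum n ys)) (*-identityʳ _)) ⟩
  ∑[ x ∈ xs ] χ (x ≟ y)
    ≡⟨ enum y ⟩
  1 ∎
  where
    open ≡-Reasoning
    vs : List (Vec A n)
    vs = allVecs xs n
    _≟ᵥ_ : ∀ {k} → DecidableEquality (Vec A k)
    _≟ᵥ_ = ≡-decVec _≟_

length-allVecs : (xs : List A) (n : ℕ) → length (allVecs xs n) ≡ length xs ^ n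
length-allVecs xs zero = refl
length-allVecs xs (suc n) = begin
  length (concatMap (λ x → map (x ∷_) (allVecs xs n)) xs)  ≡⟨ length-concatMap _ xs ⟩
  ∑[ x ∈ xs ] length (map (x ∷_) (allVecs xs n))           ≡⟨ ∑-cong xs (λ x → length-map (x ∷_) (allVecs xs n)) ⟩
  ∑[ x ∈ xs ] length (allVecs xs n)                        ≡⟨ ∑-const xs _ ⟩
  length xs * length (allVecs xs n)                        ≡⟨ cong (length xs *_) (length-allVecs xs n) ⟩
  length xs ^ suc n                                        ∎
  where open ≡-Reasoning

module _ {_≟_ : DecidableEquality A} (xs : List A) (enum : Enumerates _≟_ xs) where

  ∑-χ-≡×-dec : ∀ {P : A → Set} (P? : Decidable P) z → ∑[ x ∈ xs ] χ ((x ≟ z) ×-dec P? x) ≡ χ (P? z)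
  ∑-χ-≡×-dec P? z = begin
    ∑[ x ∈ xs ] χ ((x ≟ z) ×-dec P? x) ≡⟨ ∑-cong xs at-z ⟩
    ∑[ x ∈ xs ] (χ (P? z) * χ (x ≟ z)) ≡⟨ ∑-*ˡ xs (χ (P? z)) _ ⟩
    χ (P? z) * ∑[ x ∈ xs ] χ (x ≟ z)   ≡⟨ cong (χ (P? z) *_) (enum z) ⟩
    χ (P? z) * 1                        ≡⟨ *-identityʳ _ ⟩
    χ (P? z)                            ∎
    where
      open ≡-Reasoning
      at-z : ∀ x → χ ((x ≟ z) ×-dec P? x) ≡ χ (P? z) * χ (x ≟ z)
      at-z x with x ≟ z
      ... | yes refl = sym (*-identityʳ (χ (P? x)))
      ... | no _ = sym (*-zeroʳ (χ (P? z)))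

  count-without : ∀ {P : A → Set} (P? : Decidable P) z →
                  ∑[ x ∈ xs ] χ (¬? (x ≟ z) ×-dec P? x) + χ (P? z) ≡ ∑[ x ∈ xs ] χ (P? x)
  count-without P? z = begin
    ∑[ x ∈ xs ] χ (¬? (x ≟ z) ×-dec P? x) + χ (P? z)
      ≡⟨ cong (∑[ x ∈ xs ] χ (¬? (x ≟ z) ×-dec P? x) +_) (∑-χ-≡×-dec P? z) ⟨
    ∑[ x ∈ xs ] χ (¬? (x ≟ z) ×-dec P? x) + ∑[ x ∈ xs ] χ ((x ≟ z) ×-dec P? x)
      ≡⟨ ∑-distrib-+ xs _ _ ⟨
    ∑[ x ∈ xs ] (χ (¬? (x ≟ z) ×-dec P? x) + χ ((x ≟ z) ×-dec P? x))
      ≡⟨ ∑-cong xs (λ x → χ-¬?×+χ-× (x ≟ z) (P? x)) ⟩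
    ∑[ x ∈ xs ] χ (P? x) ∎
    where open ≡-Reasoning

  -- The hypotheses say that P is the image of the section g of p.
  count-section : ∀ {_≟′_ : DecidableEquality B} (ys : List B) → Enumerates _≟′_ ys →
                  ∀ {P : A → Set} (P? : Decidable P) (p : A → B) (g : B → A) →
                  (∀ y → p (g y) ≡ y) → (∀ y → P (g y)) → (∀ x → P x → x ≡ g (p x)) →
                  ∑[ x ∈ xs ] χ (P? x) ≡ length ys
  count-section {_≟′_ = _≟′_} ys enumB {P} P? p g p∘g≡id P∘g P⇒≡g∘p = begin
    ∑[ x ∈ xs ] χ (P? x)                 ≡⟨ ∑-cong xs fibre ⟩
    ∑[ x ∈ xs ] ∑[ y ∈ ys ] χ (x ≟ g y)  ≡⟨ ∑-swap xs ys _ ⟩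
    ∑[ y ∈ ys ] ∑[ x ∈ xs ] χ (x ≟ g y)  ≡⟨ ∑-cong ys (λ y → enum (g y)) ⟩
    ∑[ y ∈ ys ] 1                        ≡⟨ ∑-const ys 1 ⟩
    length ys * 1                        ≡⟨ *-identityʳ _ ⟩
    length ys                            ∎
    where
      open ≡-Reasoning
      agree : ∀ x → P x → ∀ y → χ (x ≟ g y) ≡ χ (y ≟′ p x)
      agree x Px y with x ≟ g y | y ≟′ p x
      ... | yes _ | yes _ = refl
      ... | no _ | no _ = refl
      ... | yes x≡gy | no y≢px = ⊥-elim (y≢px (trans (sym (p∘g≡id y)) (cong p (sym x≡gy))))
      ... | no x≢gy | yes y≡px = ⊥-elim (x≢gy (trans (P⇒≡g∘p x Px) (cong g (sym y≡px))))
      fibre : ∀ x → χ (P? x) ≡ ∑[ y ∈ ys ] χ (x ≟ g y)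
      fibre x with P? x
      ... | yes Px = sym (trans (∑-cong ys (agree x Px)) (enumB (p x)))
      ... | no ¬Px = sym (trans (∑-cong ys miss) (∑-zero ys))
        where miss : ∀ y → χ (x ≟ g y) ≡ 0
              miss y with x ≟ g y
              ... | yes refl = ⊥-elim (¬Px (P∘g y))
              ... | no _ = refl

-- Words as integers modulo 2 ^ w

_mod2^_ : ℕ → ℕ → ℕ
n mod2^ w = n % 2 ^ w
  where instance _ = m^n≢0 2 w

bit : Bool → ℕ
bit b = if b then 1 else 0

bit<2 : ∀ b → bit b < 2
bit<2 false = s≤s z≤n
bit<2 true = s≤s (s≤s z≤n)

[bit+2*n]%2≡bit : ∀ b n → (bit b + 2 * n) % 2 ≡ bit b
[bit+2*n]%2≡bit b n = begin
  (bit b + 2 * n) % 2 ≡⟨ cong (λ k → (bit b + k) % 2) (*-comm 2 n) ⟩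
  (bit b + n * 2) % 2 ≡⟨ [m+kn]%n≡m%n (bit b) n 2 ⟩
  bit b % 2           ≡⟨ m<n⇒m%n≡m (bit<2 b) ⟩
  bit b               ∎
  where open ≡-Reasoning

[bit+2*n]/2≡n : ∀ b n → (bit b + 2 * n) / 2 ≡ n
[bit+2*n]/2≡n b n = *-cancelʳ-≡ (k / 2) n 2 (+-cancelˡ-≡ (bit b) _ _ (begin
  bit b + k / 2 * 2 ≡⟨ cong (_+ k / 2 * 2) ([bit+2*n]%2≡bit b n) ⟨
  k % 2 + k / 2 * 2 ≡⟨ m≡m%n+[m/n]*n k 2 ⟨
  k                 ≡⟨ cong (bit b +_) (*-comm 2 n) ⟩
  bit b + n * 2     ∎))
  where
    open ≡-Reasoning
    k : ℕ
    k = bit b + 2 * n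

bit-%2≡ᵇ1 : ∀ n → bit (n % 2 ≡ᵇ 1) ≡ n % 2
bit-%2≡ᵇ1 n with n % 2 | m%n<n n 2
... | 0 | _ = refl
... | 1 | _ = refl
... | suc (suc _) | s≤s (s≤s ())

fromℕW-val : ∀ {w} (x : Word w) → fromℕW w (val x) ≡ x
fromℕW-val [] = refl
fromℕW-val {suc w} (b ∷ x) = cong₂ _∷_
  (trans (cong (_≡ᵇ 1) ([bit+2*n]%2≡bit b (val x))) (bit≡ᵇ1 b))
  (trans (cong (fromℕW w) ([bit+2*n]/2≡n b (val x))) (fromℕW-val x))
  where
    bit≡ᵇ1 : ∀ b → (bit b ≡ᵇ 1) ≡ b
    bit≡ᵇ1 false = refl
    bit≡ᵇ1 true = refl

val-fromℕW : ∀ w n → val (fromℕW w n) ≡ n mod2^ w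
val-fromℕW zero n = sym (n%1≡0 n)
val-fromℕW (suc w) n = begin
  bit (n % 2 ≡ᵇ 1) + 2 * val (fromℕW w (n / 2)) ≡⟨ cong₂ (λ i j → i + 2 * j) (bit-%2≡ᵇ1 n) (val-fromℕW w (n / 2)) ⟩
  n % 2 + 2 * (n / 2 % 2 ^ w)                  ≡⟨ cong₂ (λ i j → i + 2 * j) r%2 r/2 ⟨
  r % 2 + 2 * (r / 2)                           ≡⟨ cong (r % 2 +_) (*-comm 2 (r / 2)) ⟩
  r % 2 + r / 2 * 2                             ≡⟨ m≡m%n+[m/n]*n r 2 ⟨
  r                                             ∎
  where
    open ≡-Reasoning
    instance _ = m^n≢0 2 w
             _ = m^n≢0 2 (suc w)
             _ = m*n≢0 (2 ^ w) 2
    r : ℕ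
    r = n % 2 ^ suc w
    r%2 : r % 2 ≡ n % 2
    r%2 = m∣n⇒o%n%m≡o%m 2 (2 ^ suc w) n (m∣m*n (2 ^ w))
    r/2 : r / 2 ≡ n / 2 % 2 ^ w
    r/2 = trans (/-congˡ (%-congʳ (*-comm 2 (2 ^ w)))) (m%[n*o]/o≡m/o%n n (2 ^ w) 2)

module _ {w : ℕ} where

  private instance 2^w≢0 = m^n≢0 2 w

  val-injective : ∀ {x y : Word w} → val x ≡ val y → x ≡ y
  val-injective {x} {y} eq = trans (sym (fromℕW-val x)) (trans (cong (fromℕW w) eq) (fromℕW-val y))

  val<2^w : ∀ (x : Word w) → val x < 2 ^ w
  val<2^w x = subst (_< 2 ^ w) (trans (sym (val-fromℕW w (val x))) (cong val (fromℕW-val x))) (m%n<n (val x) (2 ^ w))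

  [m%2^w+n]%2^w : ∀ m n → (m % 2 ^ w + n) % 2 ^ w ≡ (m + n) % 2 ^ w
  [m%2^w+n]%2^w m n = begin
    (m % P + n) % P         ≡⟨ %-distribˡ-+ (m % P) n P ⟩
    (m % P % P + n % P) % P ≡⟨ cong (λ i → (i + n % P) % P) (m%n%n≡m%n m P) ⟩
    (m % P + n % P) % P     ≡⟨ %-distribˡ-+ m n P ⟨
    (m + n) % P             ∎
    where
      open ≡-Reasoning
      P : ℕ
      P = 2 ^ w

  -- The 2 ^ w keeps ∸ from truncating.
  _-W_ : Word w → Word w → Word w
  z -W y = fromℕW w (2 ^ w ∸ val y + val z)

  -W-+W : ∀ (z y : Word w) → (z -W y) +W y ≡ z
  -W-+W z y = val-injective (begin
    val (fromℕW w (val (z -W y) + val y))    ≡⟨ val-fromℕW w _ ⟩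
    (val (fromℕW w M) + val y) % P          ≡⟨ cong (λ i → (i + val y) % P) (val-fromℕW w M) ⟩
    (M % P + val y) % P                     ≡⟨ [m%2^w+n]%2^w M (val y) ⟩
    (P ∸ val y + val z + val y) % P         ≡⟨ cong (_% P) (+-comm (P ∸ val y + val z) (val y)) ⟩
    (val y + (P ∸ val y + val z)) % P       ≡⟨ cong (_% P) (+-assoc (val y) (P ∸ val y) (val z)) ⟨
    (val y + (P ∸ val y) + val z) % P       ≡⟨ cong (λ i → (i + val z) % P) (m+[n∸m]≡n (<⇒≤ (val<2^w y))) ⟩
    (P + val z) % P                         ≡⟨ cong (_% P) (+-comm P (val z)) ⟩
    (val z + P) % P                         ≡⟨ [m+n]%n≡m%n (val z) P ⟩
    val z % P                               ≡⟨ m<n⇒m%n≡m (val<2^w z) ⟩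
    val z                                   ∎)
    where
      open ≡-Reasoning
      P : ℕ
      P = 2 ^ w
      M : ℕ
      M = P ∸ val y + val z

  +W--W : ∀ (x y : Word w) → (x +W y) -W y ≡ x
  +W--W x y = val-injective (begin
    val (fromℕW w (P ∸ val y + val (x +W y)))  ≡⟨ val-fromℕW w _ ⟩
    (P ∸ val y + val (x +W y)) % P             ≡⟨ cong (λ i → (P ∸ val y + i) % P) (val-fromℕW w (val x + val y)) ⟩
    (P ∸ val y + (val x + val y) % P) % P      ≡⟨ cong (_% P) (+-comm (P ∸ val y) _) ⟩
    ((val x + val y) % P + (P ∸ val y)) % P    ≡⟨ [m%2^w+n]%2^w (val x + val y) (P ∸ val y) ⟩
    (val x + val y + (P ∸ val y)) % P          ≡⟨ cong (_% P) (+-assoc (val x) (val y) (P ∸ val y)) ⟩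
    (val x + (val y + (P ∸ val y))) % P        ≡⟨ cong (λ i → (val x + i) % P) (m+[n∸m]≡n (<⇒≤ (val<2^w y))) ⟩
    (val x + P) % P                            ≡⟨ [m+n]%n≡m%n (val x) P ⟩
    val x % P                                  ≡⟨ m<n⇒m%n≡m (val<2^w x) ⟩
    val x                                      ∎)
    where
      open ≡-Reasoning
      P : ℕ
      P = 2 ^ w

unsnoc : ∀ {n} → Vec A (suc n) → List A × A
unsnoc v = toList (initV v) , lastV v

initV-∷ʳ : ∀ {n} (v : Vec A n) x → initV (v ∷ʳ x) ≡ v
initV-∷ʳ [] x = refl
initV-∷ʳ (y ∷ []) x = refl
initV-∷ʳ (y ∷ z ∷ zs) x = cong (y ∷_) (initV-∷ʳ (z ∷ zs) x)

lastV-∷ʳ : ∀ {n} (v : Vec A n) x → lastV (v ∷ʳ x) ≡ x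
lastV-∷ʳ [] x = refl
lastV-∷ʳ (y ∷ []) x = refl
lastV-∷ʳ (y ∷ z ∷ zs) x = lastV-∷ʳ (z ∷ zs) x

initV-∷ʳ-lastV : ∀ {n} (v : Vec A (suc n)) → initV v ∷ʳ lastV v ≡ v
initV-∷ʳ-lastV (x ∷ []) = refl
initV-∷ʳ-lastV (x ∷ y ∷ ys) = cong (x ∷_) (initV-∷ʳ-lastV (y ∷ ys))

unsnoc-snoc2 : ∀ {n} (v : Vec A n) x y → unsnoc (snoc2 v x y) ≡ (toList v ++ [ x ] , y)
unsnoc-snoc2 [] x y = refl
unsnoc-snoc2 (z ∷ []) x y = refl
unsnoc-snoc2 (z ∷ z′ ∷ zs) x y = cong (λ { (f , ℓ) → z ∷ f , ℓ }) (unsnoc-snoc2 (z′ ∷ zs) x y)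

initV-replicate : ∀ n (x : A) → initV (replicate (suc n) x) ≡ replicate n x
initV-replicate zero x = refl
initV-replicate (suc n) x = cong (x ∷_) (initV-replicate n x)

lastV-replicate : ∀ n (x : A) → lastV (replicate (suc n) x) ≡ x
lastV-replicate zero x = refl
lastV-replicate (suc n) x = lastV-replicate n x

zeroW-⊕ : ∀ w → zeroW w ⊕ zeroW w ≡ zeroW w
zeroW-⊕ zero = refl
zeroW-⊕ (suc w) = cong (false ∷_) (zeroW-⊕ w)

rotl1-zeroW : ∀ w → rotl1 (zeroW w) ≡ zeroW w
rotl1-zeroW zero = refl
rotl1-zeroW (suc w) = cong₂ _∷_ (lastV-replicate w false) (initV-replicate w false)

rotl-zeroW : ∀ w r → rotl (zeroW w) r ≡ zeroW w
rotl-zeroW w zero = refl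
rotl-zeroW w (suc r) = trans (cong rotl1 (rotl-zeroW w r)) (rotl1-zeroW w)

zeroW-+W : ∀ w → zeroW w +W zeroW w ≡ zeroW w
zeroW-+W w = begin
  fromℕW w (val (zeroW w) + val (zeroW w)) ≡⟨ cong (λ n → fromℕW w (n + n)) (val-zeroW w) ⟩
  fromℕW w 0                               ≡⟨ cong (fromℕW w) (val-zeroW w) ⟨
  fromℕW w (val (zeroW w))                 ≡⟨ fromℕW-val (zeroW w) ⟩
  zeroW w                                  ∎
  where
    val-zeroW : ∀ w → val (zeroW w) ≡ 0
    val-zeroW zero = refl
    val-zeroW (suc w) = cong (2 *_) (val-zeroW w)
    open ≡-Reasoning

-- Shift registers

-- A state is ((s₀ , … , s_{k−2}) , s_{k−1}); penultimate′ and last′ compute the new s_{k−2} and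
-- s_{k−1} from s₀ and s_{k−1}, and the output is s₀ ∙ s_{k−1}.
module ShiftRegister {A : Set} (penultimate′ last′ : A → A → A) (_∙_ : A → A → A) where

  step : List A × A → List A × A
  step ([] , ℓ) = [] , ℓ
  step (x ∷ f , ℓ) = f ++ [ penultimate′ x ℓ ] , last′ x ℓ

  out : List A × A → A
  out ([] , ℓ) = ℓ
  out (x ∷ _ , ℓ) = x ∙ ℓ

  run : ℕ → List A × A → List A
  run zero r = []
  run (suc d) r = out r ∷ run d (step r)

  observe : ∀ {n} → Vec A n → A → Vec A n
  observe [] ℓ = []
  observe (x ∷ f) ℓ = (x ∙ ℓ) ∷ observe f (last′ x ℓ)

  -- Words appended at the back are not shifted to the front within n steps.
  run-prefix : ∀ {n} (f : Vec A n) e ℓ → run n (toList f ++ e , ℓ) ≡ toList (observe f ℓ)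
  run-prefix [] e ℓ = refl
  run-prefix (x ∷ f) e ℓ = cong ((x ∙ ℓ) ∷_) (begin
    run _ ((toList f ++ e) ++ [ penultimate′ x ℓ ] , last′ x ℓ)  ≡⟨ cong (λ g → run _ (g , last′ x ℓ)) (++-assoc (toList f) e _) ⟩
    run _ (toList f ++ (e ++ [ penultimate′ x ℓ ]) , last′ x ℓ)  ≡⟨ run-prefix f _ _ ⟩
    toList (observe f (last′ x ℓ))                             ∎)
    where open ≡-Reasoning

  observe-replicate : ∀ {z} → last′ z z ≡ z → z ∙ z ≡ z → ∀ n → observe (replicate n z) z ≡ replicate n z
  observe-replicate last′-z ∙-z zero = refl
  observe-replicate last′-z ∙-z (suc n) rewrite last′-z =
    cong₂ _∷_ ∙-z (observe-replicate last′-z ∙-z n)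

  module Inverse (_∕_ : A → A → A) (∕-∙ : ∀ z y → (z ∕ y) ∙ y ≡ z) (∙-∕ : ∀ x y → (x ∙ y) ∕ y ≡ x) where

    unobserve : ∀ {n} → Vec A n → A → Vec A n
    unobserve [] ℓ = []
    unobserve (o ∷ os) ℓ = (o ∕ ℓ) ∷ unobserve os (last′ (o ∕ ℓ) ℓ)

    observe-unobserve : ∀ {n} (os : Vec A n) ℓ → observe (unobserve os ℓ) ℓ ≡ os
    observe-unobserve [] ℓ = refl
    observe-unobserve (o ∷ os) ℓ = cong₂ _∷_ (∕-∙ o ℓ) (observe-unobserve os _)

    unobserve-observe : ∀ {n} (f : Vec A n) ℓ → unobserve (observe f ℓ) ℓ ≡ f
    unobserve-observe [] ℓ = refl
    unobserve-observe (x ∷ f) ℓ rewrite ∙-∕ x ℓ = cong (x ∷_) (unobserve-observe f (last′ x ℓ))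

-- The first k − 1 outputs of xoroshiro+

module XoroshiroPlus (w m a b c : ℕ) where

  open ShiftRegister (λ x ℓ → ((rotl x a ⊕ x) ⊕ ℓ) ⊕ ((x ⊕ ℓ) ≪ b)) (λ x ℓ → rotl (x ⊕ ℓ) c) (_+W_ {w})
  open Inverse (_-W_ {w}) -W-+W +W--W

  St : Set
  St = State w (suc (suc m))

  T : St → St
  T = xoroshiroNext m a b c

  φ : St → Word w
  φ = xoroshiroPlusOut m

  firstOutputs : St → Vec (Word w) (suc m)
  firstOutputs = outputs T φ (suc m)

  toList-outputs : ∀ d s → toList (outputs T φ d s) ≡ run d (unsnoc s)
  toList-outputs zero s = refl
  toList-outputs (suc d) s@(_ ∷ s₁ ∷ ss) =
    cong (φ s ∷_) (trans (toList-outputs d (T s)) (cong (run d) (unsnoc-snoc2 (initV (s₁ ∷ ss)) _ _)))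

  firstOutputs≡observe : ∀ s → firstOutputs s ≡ observe (initV s) (lastV s)
  firstOutputs≡observe s = trans (sym (cast-is-id refl _)) (toList-injective refl _ _ (begin
    toList (firstOutputs s)                         ≡⟨ toList-outputs (suc m) s ⟩
    run (suc m) (toList (initV s) , lastV s)        ≡⟨ cong (λ f → run (suc m) (f , lastV s)) (++-identityʳ _) ⟨
    run (suc m) (toList (initV s) ++ [] , lastV s)  ≡⟨ run-prefix (initV s) [] (lastV s) ⟩
    toList (observe (initV s) (lastV s))            ∎))
    where open ≡-Reasoning

  withLast : Vec (Word w) (suc m) → Word w → St
  withLast t u = unobserve t u ∷ʳ u

  firstOutputs-withLast : ∀ t u → firstOutputs (withLast t u) ≡ t
  firstOutputs-withLast t u = begin
    firstOutputs (withLast t u)                            ≡⟨ firstOutputs≡observe (withLast t u) ⟩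
    observe (initV (withLast t u)) (lastV (withLast t u))  ≡⟨ cong₂ observe (initV-∷ʳ (unobserve t u) u) (lastV-∷ʳ (unobserve t u) u) ⟩
    observe (unobserve t u) u                              ≡⟨ observe-unobserve t u ⟩
    t                                                      ∎
    where open ≡-Reasoning

  withLast-firstOutputs : ∀ s → withLast (firstOutputs s) (lastV s) ≡ s
  withLast-firstOutputs s = begin
    unobserve (firstOutputs s) (lastV s) ∷ʳ lastV s                ≡⟨ cong (λ o → unobserve o (lastV s) ∷ʳ lastV s) (firstOutputs≡observe s) ⟩
    unobserve (observe (initV s) (lastV s)) (lastV s) ∷ʳ lastV s  ≡⟨ cong (_∷ʳ lastV s) (unobserve-observe (initV s) (lastV s)) ⟩
    initV s ∷ʳ lastV s                                            ≡⟨ initV-∷ʳ-lastV s ⟩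
    s                                                             ∎
    where open ≡-Reasoning

  zeroState : St
  zeroState = replicate (suc (suc m)) (zeroW w)

  firstOutputs-zeroState : firstOutputs zeroState ≡ replicate (suc m) (zeroW w)
  firstOutputs-zeroState = begin
    firstOutputs zeroState                                      ≡⟨ firstOutputs≡observe zeroState ⟩
    observe (initV zeroState) (lastV zeroState)                 ≡⟨ cong₂ observe (initV-replicate (suc m) (zeroW w)) (lastV-replicate (suc m) (zeroW w)) ⟩
    observe (replicate (suc m) (zeroW w)) (zeroW w)             ≡⟨ observe-replicate last′-zeroW (zeroW-+W w) (suc m) ⟩
    replicate (suc m) (zeroW w)                                 ∎
    where
      open ≡-Reasoning
      last′-zeroW : rotl (zeroW w ⊕ zeroW w) c ≡ zeroW w
      last′-zeroW = trans (cong (λ x → rotl x c) (zeroW-⊕ w)) (rotl-zeroW w c)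

  words-enumerate : Enumerates _≟W_ (allWords w)
  words-enumerate = allVecs-enumerates (false ∷ true ∷ []) Bool-enumerates w

  states-enumerate : Enumerates (≡-decVec _≟W_) (allStates w (suc (suc m)))
  states-enumerate = allVecs-enumerates (allWords w) words-enumerate (suc (suc m))

  _≟ₜ_ : DecidableEquality (Vec (Word w) (suc m))
  _≟ₜ_ = ≡-decVec _≟W_

  countTuple+zeroState : ∀ t → countTuple T φ (suc m) t + χ (firstOutputs zeroState ≟ₜ t) ≡ 2 ^ w
  countTuple+zeroState t = begin
    countTuple T φ (suc m) t + χ (O? zeroState)
      ≡⟨ cong (_+ χ (O? zeroState)) (length-filter (λ s → ¬? (s ≟ₛ zeroState) ×-dec O? s) states) ⟩
    ∑[ s ∈ states ] χ (¬? (s ≟ₛ zeroState) ×-dec O? s) + χ (O? zeroState)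
      ≡⟨ count-without {_≟_ = _≟ₛ_} states states-enumerate O? zeroState ⟩
    ∑[ s ∈ states ] χ (O? s)
      ≡⟨ count-section {_≟_ = _≟ₛ_} states states-enumerate {_≟′_ = _≟W_} (allWords w) words-enumerate
                       O? lastV (withLast t) (λ u → lastV-∷ʳ (unobserve t u) u) (firstOutputs-withLast t) fibre ⟩
    length (allWords w)
      ≡⟨ length-allVecs _ w ⟩
    2 ^ w ∎
    where
      open ≡-Reasoning
      states : List St
      states = allStates w (suc (suc m))
      _≟ₛ_ : DecidableEquality St
      _≟ₛ_ = ≡-decVec _≟W_
      O? : ∀ s → Dec (firstOutputs s ≡ t)
      O? s = firstOutputs s ≟ₜ t
      fibre : ∀ s → firstOutputs s ≡ t → s ≡ withLast t (lastV s)
      fibre s refl = sym (withLast-firstOutputs s)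

  zeroTuple : Vec (Word w) (suc m)
  zeroTuple = replicate (suc m) (zeroW w)

  countTuple-zeroTuple : countTuple T φ (suc m) zeroTuple ≡ 2 ^ w ∸ 1
  countTuple-zeroTuple = begin
    countTuple T φ (suc m) zeroTuple                                               ≡⟨ m+n∸n≡m _ 1 ⟨
    countTuple T φ (suc m) zeroTuple + 1 ∸ 1                                       ≡⟨ cong (λ i → countTuple T φ (suc m) zeroTuple + i ∸ 1) zeroState-counted ⟨
    countTuple T φ (suc m) zeroTuple + χ (firstOutputs zeroState ≟ₜ zeroTuple) ∸ 1 ≡⟨ cong (_∸ 1) (countTuple+zeroState zeroTuple) ⟩
    2 ^ w ∸ 1                                                                      ∎
    where
      open ≡-Reasoning
      zeroState-counted : χ (firstOutputs zeroState ≟ₜ zeroTuple) ≡ 1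
      zeroState-counted = χ-yes (firstOutputs zeroState ≟ₜ zeroTuple) firstOutputs-zeroState

  countTuple-nonzeroTuple : ∀ t → t ≢ zeroTuple → countTuple T φ (suc m) t ≡ 2 ^ w
  countTuple-nonzeroTuple t t≢zeroTuple = begin
    countTuple T φ (suc m) t                                        ≡⟨ +-identityʳ _ ⟨
    countTuple T φ (suc m) t + 0                                    ≡⟨ cong (countTuple T φ (suc m) t +_) zeroState-uncounted ⟨
    countTuple T φ (suc m) t + χ (firstOutputs zeroState ≟ₜ t)      ≡⟨ countTuple+zeroState t ⟩
    2 ^ w                                                           ∎
    where
      open ≡-Reasoning
      zeroState-uncounted : χ (firstOutputs zeroState ≟ₜ t) ≡ 0
      zeroState-uncounted = χ-no (firstOutputs zeroState ≟ₜ t) (λ o≡t → t≢zeroTuple (trans (sym o≡t) firstOutputs-zeroState))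

proposition8p1 : (w m a b c : ℕ) → 1 ≤ w → a < w → b < w → c < w →
    Equidistributed w (suc (suc m)) (xoroshiroNext m a b c) (xoroshiroPlusOut m) (suc m)
proposition8p1 w m a b c _ _ _ _ t rewrite m+n∸n≡m 1 m | *-identityʳ w =
  (λ { refl → countTuple-zeroTuple }) , countTuple-nonzeroTuple t
  where open XoroshiroPlus w m a b c
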